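{- Let $k>1$ be an integer. Every $k$-reverse multiple and every perfect $(\sigma,k)$-permutiple $[a_0;a_1,\ldots,a_n]$ is symmetric, i.e. $a_ja_{n-j}=a_{\sigma(j)}a_{\sigma(n-j)}$ for all $0\le j\le n$.
   Context: For positive integers $a_0,\ldots,a_n$, $[a_0;a_1,\ldots,a_n]$ denotes the finite simple continued fraction $a_0+1/(a_1+1/(\cdots+1/a_n))$; all finite continued fractions are assumed in canonical form (last digit at least $2$ when there are at least two digits). For an integer $k>1$ and a permutation $\sigma$ of $\{0,\ldots,n\}$, $r=[a_0;\ldots,a_n]$ is a $(\sigma,k)$-permutiple if $r=k\,[a_{\sigma(0)};a_{\sigma(1)},\ldots,a_{\sigma(n)}]$. A $k$-reverse multiple is a $(\sigma,k)$-permutiple with $\sigma(j)=n-j$ for all $j$. A $(\sigma,k)$-permutiple is perfect if $a_j=k\,a_{\sigma(j)}$ for every even $j$ and $a_{\sigma(j)}=k\,a_j$ for every odd $j$ ($0\le j\le n$). It is symmetric if $a_ja_{n-j}=a_{\sigma(j)}a_{\sigma(n-j)}$ for all $0\le j\le n$. -}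

module Defs where

open import Data.Nat using (ℕ; zero; suc; _+_; _*_; _≤_; _<_; _%_)
open import Data.Fin using (Fin; zero; suc; toℕ; opposite; fromℕ)
open import Data.Fin.Permutation using (Permutation′; _⟨$⟩ʳ_)
open import Data.Product using (_×_; _,_; proj₁; proj₂)
open import Data.Unit using (⊤)
open import Relation.Binary.PropositionalEquality using (_≡_)

-- A finite continued fraction with digits a₀,…,aₙ is given by
-- a : Fin (suc n) → ℕ  (digit a_j is  a j).

-- Numerator/denominator (p , q) of [a₀; a₁, …, aₙ] computed by the
-- standard recursion  [a₀] = a₀/1,  [a₀; rest] = a₀ + 1/[rest] = (a₀ p + q)/p
-- where [rest] = p/q.
cfFrac : (n : ℕ) → (Fin (suc n) → ℕ) → ℕ × ℕ
cfFrac zero    a = a zero , 1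
cfFrac (suc n) a with cfFrac n (λ j → a (suc j))
... | (p , q) = a zero * p + q , p

Positive : {n : ℕ} → (Fin (suc n) → ℕ) → Set
Positive a = ∀ j → 1 ≤ a j

Canonical : (n : ℕ) → (Fin (suc n) → ℕ) → Set
Canonical zero    a = ⊤
Canonical (suc n) a = 2 ≤ a (fromℕ (suc n))

-- The value of the continued fraction a (as numerator, denominator).
-- r = k · r'  for r = p/q, r' = p'/q' (q, q' > 0) means  p * q' = k * p' * q.
EqTimes : ℕ → ℕ × ℕ → ℕ × ℕ → Set
EqTimes k (p , q) (p' , q') = p * q' ≡ k * p' * q

IsPermutiple : (n k : ℕ) → Permutation′ (suc n) → (Fin (suc n) → ℕ) → Set
IsPermutiple n k σ a =
  Positive a × Canonical n a × Canonical n (λ j → a (σ ⟨$⟩ʳ j)) ×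
  EqTimes k (cfFrac n a) (cfFrac n (λ j → a (σ ⟨$⟩ʳ j)))

IsReversal : (n : ℕ) → Permutation′ (suc n) → Set
IsReversal n σ = ∀ j → σ ⟨$⟩ʳ j ≡ opposite j

IsPerfect : (n k : ℕ) → Permutation′ (suc n) → (Fin (suc n) → ℕ) → Set
IsPerfect n k σ a =
  ∀ j → (toℕ j % 2 ≡ 0 → a j ≡ k * a (σ ⟨$⟩ʳ j)) ×
        (toℕ j % 2 ≡ 1 → a (σ ⟨$⟩ʳ j) ≡ k * a j)

IsSymmetric : (n : ℕ) → Permutation′ (suc n) → (Fin (suc n) → ℕ) → Set
IsSymmetric n σ a =
  ∀ j → a j * a (opposite j) ≡ a (σ ⟨$⟩ʳ j) * a (σ ⟨$⟩ʳ opposite j)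

module Submission where

-- A perfect permutiple has an even number n + 1 of digits: weighting each digit
-- a_j by k^(j mod 2), perfectness says a_j k^(j mod 2) = a_σ(j) k^((j+1) mod 2), and
-- taking the product over all j (where σ only permutes the a's) compares
-- k^#(odd j) with k^#(even j), which would differ by a factor k if n were even.
-- For odd n the indices j and n - j have opposite parity, and applying perfectness
-- at the even one of them and at the odd one moves the factor k across and back.
-- For the reverse multiple, symmetry is just commutativity of a_j a_{n-j}.
-- Neither argument uses the continued-fraction identity, only positivity of digits.

open import Defs
open import Data.Nat using (ℕ; zero; suc; _+_; _*_; _^_; _<_; _≤_; _%_; s≤s; s≤s⁻¹; z<s; NonZero; >-nonZero)
open import Data.Nat.Properties
open import Data.Nat.DivMod using (%-distribˡ-+; m%n<n)
import Data.Fin as Fin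
open import Data.Fin using (Fin; toℕ; opposite)
open import Data.Fin.Properties using (opposite-involutive; opposite-prop; toℕ<n; toℕ-inject₁; toℕ-fromℕ)
open import Data.Fin.Permutation using (Permutation′; _⟨$⟩ʳ_)
open import Data.Product using (_×_; _,_; proj₁; proj₂)
open import Data.Sum using (_⊎_; inj₁; inj₂)
open import Data.Empty using (⊥-elim)
open import Function using (_∘_)
open import Relation.Binary.PropositionalEquality
open import Algebra.Properties.CommutativeMonoid.Sum *-1-commutativeMonoid
  using (sum-cong-≗; ∑-distrib-+; sum-permute; sum-init-last)
  renaming (sum to ∏)

%2-dichotomy : ∀ i → i % 2 ≡ 0 ⊎ i % 2 ≡ 1
%2-dichotomy i with i % 2 | m%n<n i 2
... | 0 | _ = inj₁ refl
... | 1 | _ = inj₂ refl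
... | suc (suc _) | s≤s (s≤s ())

+-%2 : ∀ i j {p q} → i % 2 ≡ p → j % 2 ≡ q → (i + j) % 2 ≡ (p + q) % 2
+-%2 i j refl refl = %-distribˡ-+ i j 2

suc-%2 : ∀ i {p} → i % 2 ≡ p → suc i % 2 ≡ (1 + p) % 2
suc-%2 i = +-%2 1 i refl

odd-sum⇒parity-differs : ∀ i j → (i + j) % 2 ≡ 1 →
  (i % 2 ≡ 0 → j % 2 ≡ 1) × (i % 2 ≡ 1 → j % 2 ≡ 0)
odd-sum⇒parity-differs i j odd = even⇒odd , odd⇒even
  where
  even⇒odd : i % 2 ≡ 0 → j % 2 ≡ 1
  even⇒odd i-even with %2-dichotomy j
  ... | inj₁ j-even = ⊥-elim (0≢1+n (trans (sym (+-%2 i j i-even j-even)) odd))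
  ... | inj₂ j-odd  = j-odd
  odd⇒even : i % 2 ≡ 1 → j % 2 ≡ 0
  odd⇒even i-odd with %2-dichotomy j
  ... | inj₁ j-even = j-even
  ... | inj₂ j-odd  = ⊥-elim (0≢1+n (trans (sym (+-%2 i j i-odd j-odd)) odd))

toℕ+toℕ-opposite : ∀ {n} (j : Fin (suc n)) → toℕ j + toℕ (opposite j) ≡ n
toℕ+toℕ-opposite j =
  trans (cong (toℕ j +_) (opposite-prop j)) (m+[n∸m]≡n (s≤s⁻¹ (toℕ<n j)))

opposite-parity : ∀ {n} → n % 2 ≡ 1 → (j : Fin (suc n)) →
  (toℕ j % 2 ≡ 0 → toℕ (opposite j) % 2 ≡ 1) × (toℕ j % 2 ≡ 1 → toℕ (opposite j) % 2 ≡ 0)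
opposite-parity n-odd j = odd-sum⇒parity-differs (toℕ j) (toℕ (opposite j))
  (trans (cong (_% 2) (toℕ+toℕ-opposite j)) n-odd)

∏-positive : ∀ {m} (f : Fin m → ℕ) → (∀ j → 1 ≤ f j) → 1 ≤ ∏ f
∏-positive {zero}  f pos = ≤-refl
∏-positive {suc m} f pos = *-mono-≤ (pos Fin.zero) (∏-positive (f ∘ Fin.suc) (pos ∘ Fin.suc))

∏[<] : ℕ → (ℕ → ℕ) → ℕ
∏[<] m w = ∏ {m} (w ∘ toℕ)

∏[<]-last : ∀ m (w : ℕ → ℕ) → ∏[<] (suc m) w ≡ ∏[<] m w * w m
∏[<]-last m w = trans (sum-init-last {m} (w ∘ toℕ))
  (cong₂ _*_ (sum-cong-≗ {m} (cong w ∘ toℕ-inject₁)) (cong w (toℕ-fromℕ m)))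

parityWeight : ℕ → ℕ → ℕ
parityWeight k i = k ^ (i % 2)

∏[<]-parityWeight-suc : ∀ k n → n % 2 ≡ 0 →
  ∏[<] (suc n) (parityWeight k ∘ suc) ≡ ∏[<] (suc n) (parityWeight k) * k
∏[<]-parityWeight-suc k n n-even = begin
  ∏[<] (suc n) (w ∘ suc)       ≡⟨ sym (*-identityˡ _) ⟩   -- w 0 = 1
  ∏[<] (suc (suc n)) w         ≡⟨ ∏[<]-last (suc n) w ⟩
  ∏[<] (suc n) w * w (suc n)   ≡⟨ cong (λ e → ∏[<] (suc n) w * k ^ e) (suc-%2 n n-even) ⟩
  ∏[<] (suc n) w * (k * 1)     ≡⟨ cong (∏[<] (suc n) w *_) (*-identityʳ k) ⟩
  ∏[<] (suc n) w * k           ∎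
  where
  open ≡-Reasoning
  w : ℕ → ℕ
  w = parityWeight k

module _ (k : ℕ) {n : ℕ} (σ : Permutation′ (suc n)) (a : Fin (suc n) → ℕ)
         (perfect : IsPerfect n k σ a) where

  private
    aσ : Fin (suc n) → ℕ
    aσ = a ∘ (σ ⟨$⟩ʳ_)

  perfect⇒parityWeighted : ∀ j →
    a j * parityWeight k (toℕ j) ≡ aσ j * parityWeight k (suc (toℕ j))
  perfect⇒parityWeighted j with %2-dichotomy (toℕ j)
  ... | inj₁ j-even = begin
    a j * k ^ (toℕ j % 2)          ≡⟨ cong (λ e → a j * k ^ e) j-even ⟩
    a j * 1                        ≡⟨ *-identityʳ (a j) ⟩
    a j                            ≡⟨ proj₁ (perfect j) j-even ⟩
    k * aσ j                       ≡⟨ *-comm k (aσ j) ⟩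
    aσ j * k                       ≡⟨ cong (aσ j *_) (*-identityʳ k) ⟨
    aσ j * k ^ 1                   ≡⟨ cong (λ e → aσ j * k ^ e) (sym (suc-%2 (toℕ j) j-even)) ⟩
    aσ j * k ^ (suc (toℕ j) % 2)   ∎
    where open ≡-Reasoning
  ... | inj₂ j-odd = begin
    a j * k ^ (toℕ j % 2)          ≡⟨ cong (λ e → a j * k ^ e) j-odd ⟩
    a j * k ^ 1                    ≡⟨ *-comm (a j) (k * 1) ⟩
    k * 1 * a j                    ≡⟨ cong (_* a j) (*-identityʳ k) ⟩
    k * a j                        ≡⟨ proj₂ (perfect j) j-odd ⟨
    aσ j                           ≡⟨ *-identityʳ (aσ j) ⟨
    aσ j * 1                       ≡⟨ cong (λ e → aσ j * k ^ e) (sym (suc-%2 (toℕ j) j-odd)) ⟩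
    aσ j * k ^ (suc (toℕ j) % 2)   ∎
    where open ≡-Reasoning

  perfect⇒odd : 1 < k → Positive a → n % 2 ≡ 1
  perfect⇒odd 1<k pos with %2-dichotomy n
  ... | inj₂ n-odd  = n-odd
  ... | inj₁ n-even = ⊥-elim (<-irrefl x≡x*k (m<m*n x k 1<k))
    where
    w : ℕ → ℕ
    w = parityWeight k
    x : ℕ
    x = ∏ (λ j → a j * w (toℕ j))
    instance
      k≢0 : NonZero k
      k≢0 = >-nonZero (<-trans z<s 1<k)
      x≢0 : NonZero x
      x≢0 = >-nonZero (∏-positive _ (λ j → *-mono-≤ (pos j) (m^n>0 k (toℕ j % 2))))
    x≡x*k : x ≡ x * k
    x≡x*k = begin
      x                                      ≡⟨ sum-cong-≗ perfect⇒parityWeighted ⟩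
      ∏ (λ j → aσ j * w (suc (toℕ j)))       ≡⟨ ∑-distrib-+ aσ (w ∘ suc ∘ toℕ) ⟩
      ∏ aσ * ∏[<] (suc n) (w ∘ suc)          ≡⟨ cong₂ _*_ (sym (sum-permute a σ)) (∏[<]-parityWeight-suc k n n-even) ⟩
      ∏ a * (∏[<] (suc n) w * k)             ≡⟨ *-assoc (∏ a) _ k ⟨
      ∏ a * ∏[<] (suc n) w * k               ≡⟨ cong (_* k) (∑-distrib-+ a (w ∘ toℕ)) ⟨
      x * k                                  ∎
      where open ≡-Reasoning

  perfect-odd⇒symmetric-at-even : n % 2 ≡ 1 → ∀ j → toℕ j % 2 ≡ 0 →
    a j * a (opposite j) ≡ aσ j * aσ (opposite j)
  perfect-odd⇒symmetric-at-even n-odd j j-even = begin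
    a j * a (opposite j)        ≡⟨ cong (_* a (opposite j)) (proj₁ (perfect j) j-even) ⟩
    k * aσ j * a (opposite j)   ≡⟨ cong (_* a (opposite j)) (*-comm k (aσ j)) ⟩
    aσ j * k * a (opposite j)   ≡⟨ *-assoc (aσ j) k _ ⟩
    aσ j * (k * a (opposite j)) ≡⟨ cong (aσ j *_) (proj₂ (perfect (opposite j)) opposite-odd) ⟨
    aσ j * aσ (opposite j)      ∎
    where
    open ≡-Reasoning
    opposite-odd : toℕ (opposite j) % 2 ≡ 1
    opposite-odd = proj₁ (opposite-parity n-odd j) j-even

  perfect-odd⇒symmetric : n % 2 ≡ 1 → IsSymmetric n σ a
  perfect-odd⇒symmetric n-odd j with %2-dichotomy (toℕ j)
  ... | inj₁ j-even = perfect-odd⇒symmetric-at-even n-odd j j-even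
  ... | inj₂ j-odd  = begin
    a j * a j′                    ≡⟨ *-comm (a j) (a j′) ⟩
    a j′ * a j                    ≡⟨ cong (λ i → a j′ * a i) (opposite-involutive j) ⟨
    a j′ * a (opposite j′)        ≡⟨ perfect-odd⇒symmetric-at-even n-odd j′ j′-even ⟩
    aσ j′ * aσ (opposite j′)      ≡⟨ cong (λ i → aσ j′ * aσ i) (opposite-involutive j) ⟩
    aσ j′ * aσ j                  ≡⟨ *-comm (aσ j′) (aσ j) ⟩
    aσ j * aσ j′                  ∎
    where
    open ≡-Reasoning
    j′ : Fin (suc n)
    j′ = opposite j
    j′-even : toℕ j′ % 2 ≡ 0
    j′-even = proj₂ (opposite-parity n-odd j) j-odd

reversal⇒symmetric : ∀ {n} (σ : Permutation′ (suc n)) (a : Fin (suc n) → ℕ) →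
  IsReversal n σ → IsSymmetric n σ a
reversal⇒symmetric σ a reversal j
  rewrite reversal j | reversal (opposite j) | opposite-involutive j = *-comm (a j) (a (opposite j))

theorem14 : (k : ℕ) → 1 < k → (n : ℕ) → (σ : Permutation′ (suc n)) →
    (a : Fin (suc n) → ℕ) → IsPermutiple n k σ a →
    (IsReversal n σ ⊎ IsPerfect n k σ a) → IsSymmetric n σ a
theorem14 k _ n σ a _ (inj₁ reversal) = reversal⇒symmetric σ a reversal
theorem14 k 1<k n σ a (positive , _) (inj₂ perfect) =
  perfect-odd⇒symmetric k σ a perfect (perfect⇒odd k σ a perfect 1<k positive)
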